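{- Let $\mathcal F$ be a hypergraph on $n$ vertices and let $i$ be an integer with $0<i<n$ such that $\wp(\mathcal F,i)\le\frac{|\mathcal F|}{2}$. Then $\mathcal F$ has at least $i$ vertices of degree at least $\frac{|\mathcal F|}{2n}$.
   Context: For a hypergraph $\mathcal F$ on vertex set $V$ and integer $i$, $\wp(\mathcal F,i)=\max_{I\subseteq V,|I|=i}|\{e\in\mathcal F: e\subseteq I\}|$. The degree of a vertex is the number of edges containing it. -}

module Defs where

open import Data.Nat using (ℕ; zero; suc; _⊔_; _≟_)
open import Data.Bool using (true; false)
open import Data.Fin using (Fin)
open import Data.Fin.Subset using (Subset; _∈_; _⊆_; ∣_∣)
open import Data.Fin.Subset.Properties using (_∈?_; _⊆?_)
open import Data.List using (List; []; _∷_; length; filter; map; foldr; _++_)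
open import Data.List.Relation.Unary.Unique.Propositional using (Unique)
open import Data.Vec using (_∷_; [])

record Hypergraph (n : ℕ) : Set where
  field
    edges  : List (Subset n)
    unique : Unique edges

open Hypergraph public

size : ∀ {n} → Hypergraph n → ℕ
size F = length (edges F)

degree : ∀ {n} → Hypergraph n → Fin n → ℕ
degree F v = length (filter (v ∈?_) (edges F))

edgesInside : ∀ {n} → Hypergraph n → Subset n → ℕ
edgesInside F I = length (filter (_⊆? I) (edges F))

allSubsets : (n : ℕ) → List (Subset n)
allSubsets zero = [] ∷ []
allSubsets (suc n) = map (true ∷_) (allSubsets n) ++ map (false ∷_) (allSubsets n)

maxList : List ℕ → ℕ
maxList = foldr _⊔_ 0

wp : ∀ {n} → Hypergraph n → ℕ → ℕ
wp {n} F i = maxList (map (edgesInside F) (filter (λ I → ∣ I ∣ ≟ i) (allSubsets n)))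

-- Let S be the set of vertices of degree at least |F|/2n.  If |S| < i, enlarge S
-- to a set I of exactly i vertices.  An edge not inside I contains a vertex
-- outside I, which has degree below |F|/2n, so fewer than n · |F|/2n = |F|/2
-- edges leave I.  Hence more than |F|/2 edges lie inside I, contradicting
-- ℘(F,i) ≤ |F|/2.  (For |F| = 0 every vertex qualifies.)
module Submission where

open import Defs
open import Data.Nat using (ℕ; _<_; _≤_; _*_)
open import Data.Product using (Σ; _×_)
open import Data.Fin.Subset using (Subset; _∈_; ∣_∣)

open import Data.Bool using (true; false; if_then_else_)
open import Data.Empty using (⊥-elim)
open import Data.Fin using (Fin; zero; suc)
open import Data.Fin.Properties using (¬∀⟶∃¬)
open import Data.Fin.Subset using (_⊆_; _∉_; ⊤; inside; outside)
open import Data.Fin.Subset.Properties using (_∈?_; _⊆?_; ⊆-refl; ⊆⊤; ∣⊤∣≡n; s⊆s)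
open import Data.List using (List; []; _∷_; length; filter; map)
open import Data.List.Membership.Propositional as List using ()
open import Data.List.Membership.Propositional.Properties using (∈-map⁺; ∈-++⁺ˡ; ∈-++⁺ʳ; ∈-filter⁺)
open import Data.List.Relation.Unary.Any using (here; there)
open import Data.Nat using (zero; suc; _+_; z≤n; s≤s; _≤?_; _≟_)
open import Data.Nat.Properties
open import Data.Product using (∃-syntax; _,_)
open import Data.Sum using (inj₁; inj₂)
open import Data.Vec using (tabulate; []; _∷_)
open import Data.Vec.Properties using (lookup∘tabulate; []=⇒lookup; lookup⇒[]=)
open import Function using (_∘_)
open import Relation.Binary.PropositionalEquality using (_≡_; refl; sym; trans; cong; subst)
open import Relation.Nullary using (¬_; yes; no; does; contradiction)
open import Relation.Nullary.Decidable using (dec-true; _→-dec_)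
open import Relation.Unary using (Pred; Decidable)

open import Algebra.Properties.Semiring.Sum +-*-semiring using (sum; *-distribˡ-sum)

∑-mono-≤ : ∀ {n} {f g : Fin n → ℕ} → (∀ v → f v ≤ g v) → sum f ≤ sum g
∑-mono-≤ {zero}  f≤g = z≤n
∑-mono-≤ {suc n} f≤g = +-mono-≤ (f≤g zero) (∑-mono-≤ (f≤g ∘ suc))

∑-mono-< : ∀ {n} {f g : Fin n → ℕ} → (∀ v → f v ≤ g v) → ∀ w → f w < g w → sum f < sum g
∑-mono-< f≤g zero    fw<gw = +-mono-<-≤ fw<gw (∑-mono-≤ (f≤g ∘ suc))
∑-mono-< f≤g (suc w) fw<gw = +-mono-≤-< (f≤g zero) (∑-mono-< (f≤g ∘ suc) w fw<gw)

∑-const : ∀ n c → sum {n} (λ _ → c) ≡ n * c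
∑-const zero    c = refl
∑-const (suc n) c = cong (c +_) (∑-const n c)

∑-<-* : ∀ {n} {f : Fin n → ℕ} {c} → 0 < n → (∀ v → f v < c) → sum f < n * c
∑-<-* {suc n} {f} {c} _ f<c =
  subst (sum f <_) (∑-const (suc n) c) (∑-mono-< (<⇒≤ ∘ f<c) zero (f<c zero))

subsetOf : ∀ {n ℓ} {P : Pred (Fin n) ℓ} → Decidable P → Subset n
subsetOf P? = tabulate (does ∘ P?)

∈-subsetOf⁺ : ∀ {n ℓ} {P : Pred (Fin n) ℓ} (P? : Decidable P) {v} → P v → v ∈ subsetOf P?
∈-subsetOf⁺ P? {v} Pv = lookup⇒[]= v _ (trans (lookup∘tabulate (does ∘ P?) v) (dec-true (P? v) Pv))

∈-subsetOf⁻ : ∀ {n ℓ} {P : Pred (Fin n) ℓ} (P? : Decidable P) {v} → v ∈ subsetOf P? → P v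
∈-subsetOf⁻ P? {v} v∈ with P? v | trans (sym (lookup∘tabulate (does ∘ P?) v)) ([]=⇒lookup v∈)
... | yes Pv | _  = Pv
... | no  _  | ()

⊈⇒∃∈∉ : ∀ {n} {p q : Subset n} → ¬ p ⊆ q → ∃[ v ] v ∈ p × v ∉ q
⊈⇒∃∈∉ {n} {p} {q} p⊈q
  with v , v∈p⇏v∈q ← ¬∀⟶∃¬ n _ (λ v → v ∈? p →-dec v ∈? q) (λ p⊆q → p⊈q (p⊆q _))
  with v ∈? p
... | yes v∈p = v , v∈p , λ v∈q → v∈p⇏v∈q (λ _ → v∈q)
... | no  v∉p = ⊥-elim (v∈p⇏v∈q (λ v∈p → contradiction v∈p v∉p))

superset-of-size : ∀ {n} k (p : Subset n) → ∣ p ∣ ≤ k → k ≤ n →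
                   ∃[ q ] p ⊆ q × ∣ q ∣ ≡ k
superset-of-size zero    []           _          _         = [] , ⊆-refl , refl
superset-of-size (suc k) (inside ∷ p) (s≤s p≤k) (s≤s k≤n)
  with q , p⊆q , ∣q∣≡k ← superset-of-size k p p≤k k≤n
  = inside ∷ q , s⊆s p⊆q , cong suc ∣q∣≡k
superset-of-size {suc n} k (outside ∷ p) p≤k k≤1+n with m≤n⇒m<n∨m≡n k≤1+n
... | inj₂ refl      = ⊤ , ⊆⊤ , ∣⊤∣≡n (suc n)
... | inj₁ (s≤s k≤n)
  with q , p⊆q , ∣q∣≡k ← superset-of-size k p p≤k k≤n
  = outside ∷ q , s⊆s p⊆q , ∣q∣≡k

∈-allSubsets : ∀ n (p : Subset n) → p List.∈ allSubsets n
∈-allSubsets zero    []           = here refl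
∈-allSubsets (suc n) (inside ∷ p) = ∈-++⁺ˡ (∈-map⁺ (inside ∷_) (∈-allSubsets n p))
∈-allSubsets (suc n) (outside ∷ p) =
  ∈-++⁺ʳ (map (inside ∷_) (allSubsets n)) (∈-map⁺ (outside ∷_) (∈-allSubsets n p))

≤-maxList : ∀ {x xs} → x List.∈ xs → x ≤ maxList xs
≤-maxList {xs = y ∷ ys} (here refl) = m≤m⊔n y (maxList ys)
≤-maxList {xs = y ∷ ys} (there x∈ys) = ≤-trans (≤-maxList x∈ys) (m≤n⊔m y (maxList ys))

edgesInside≤wp : ∀ {n} (F : Hypergraph n) (I : Subset n) → edgesInside F I ≤ wp F ∣ I ∣
edgesInside≤wp {n} F I =
  ≤-maxList (∈-map⁺ (edgesInside F) (∈-filter⁺ (λ J → ∣ J ∣ ≟ ∣ I ∣) (∈-allSubsets n I) refl))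

degreeOutside : ∀ {n} → Subset n → List (Subset n) → Fin n → ℕ
degreeOutside I E v = if does (v ∈? I) then 0 else length (filter (v ∈?_) E)

degreeOutside-∷-≤ : ∀ {n} (I e : Subset n) E v → degreeOutside I E v ≤ degreeOutside I (e ∷ E) v
degreeOutside-∷-≤ I e E v with does (v ∈? I) | does (v ∈? e)
... | true  | _     = ≤-refl
... | false | true  = n≤1+n _
... | false | false = ≤-refl

degreeOutside-∷-< : ∀ {n} (I e : Subset n) E {v} → v ∈ e → v ∉ I →
                    degreeOutside I E v < degreeOutside I (e ∷ E) v
degreeOutside-∷-< I e E {v} v∈e v∉I with v ∈? I | v ∈? e
... | yes v∈I | _      = contradiction v∈I v∉I
... | no _    | yes _  = ≤-refl
... | no _    | no v∉e = contradiction v∈e v∉e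

length≤inside+∑degreeOutside : ∀ {n} (I : Subset n) (E : List (Subset n)) →
  length E ≤ length (filter (_⊆? I) E) + sum (degreeOutside I E)
length≤inside+∑degreeOutside I [] = z≤n
length≤inside+∑degreeOutside I (e ∷ E) with e ⊆? I
... | yes _ = s≤s (≤-trans (length≤inside+∑degreeOutside I E)
                          (+-monoʳ-≤ _ (∑-mono-≤ (degreeOutside-∷-≤ I e E))))
... | no e⊈I with v , v∈e , v∉I ← ⊈⇒∃∈∉ e⊈I = begin-strict
  length E                              ≤⟨ length≤inside+∑degreeOutside I E ⟩
  #inside + sum (degreeOutside I E)     <⟨ +-monoʳ-< #inside (∑-mono-< (degreeOutside-∷-≤ I e E) v
                                                               (degreeOutside-∷-< I e E v∈e v∉I)) ⟩
  #inside + sum (degreeOutside I (e ∷ E)) ∎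
  where
  open ≤-Reasoning
  #inside : ℕ
  #inside = length (filter (_⊆? I) E)

m≤a+b∧2b<m⇒m<2a : ∀ {m a b} → m ≤ a + b → 2 * b < m → m < 2 * a
m≤a+b∧2b<m⇒m<2a {m} {a} {b} m≤a+b 2b<m = +-cancelʳ-< m m (2 * a) (begin-strict
  m + m           ≡⟨ cong (m +_) (sym (+-identityʳ m)) ⟩
  2 * m           ≤⟨ *-monoʳ-≤ 2 m≤a+b ⟩
  2 * (a + b)     ≡⟨ *-distribˡ-+ 2 a b ⟩
  2 * a + 2 * b   <⟨ +-monoʳ-< (2 * a) 2b<m ⟩
  2 * a + m       ∎)
  where open ≤-Reasoning

HighDegree : ∀ {n} → Hypergraph n → Fin n → Set
HighDegree {n} F v = size F ≤ 2 * n * degree F v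

highDegree? : ∀ {n} (F : Hypergraph n) → Decidable (HighDegree F)
highDegree? {n} F v = size F ≤? 2 * n * degree F v

highDegreeVertices : ∀ {n} → Hypergraph n → Subset n
highDegreeVertices F = subsetOf (highDegree? F)

majority-inside-if-outside-low : ∀ {n} (F : Hypergraph n) (I : Subset n) → 0 < n →
  (∀ v → v ∉ I → ¬ HighDegree F v) → 0 < size F → size F < 2 * edgesInside F I
majority-inside-if-outside-low {n} F I 0<n outside-low 0<m =
  m≤a+b∧2b<m⇒m<2a {b = b} (length≤inside+∑degreeOutside I (edges F)) 2b<m
  where
  b : ℕ
  b = sum (degreeOutside I (edges F))

  2n·degreeOutside<m : ∀ v → 2 * n * degreeOutside I (edges F) v < size F
  2n·degreeOutside<m v with v ∈? I
  ... | yes _   = subst (_< size F) (sym (*-zeroʳ (2 * n))) 0<m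
  ... | no  v∉I = ≰⇒> (outside-low v v∉I)

  n·2b<n·m : n * (2 * b) < n * size F
  n·2b<n·m = begin-strict
    n * (2 * b)       ≡⟨ sym (*-assoc n 2 b) ⟩
    n * 2 * b         ≡⟨ cong (_* b) (*-comm n 2) ⟩
    2 * n * b         ≡⟨ *-distribˡ-sum (2 * n) (degreeOutside I (edges F)) ⟩
    sum (λ v → 2 * n * degreeOutside I (edges F) v) <⟨ ∑-<-* 0<n 2n·degreeOutside<m ⟩
    n * size F        ∎
    where open ≤-Reasoning

  2b<m : 2 * b < size F
  2b<m = *-cancelˡ-< n (2 * b) (size F) n·2b<n·m

wp-large-if-few-high-degree : ∀ {n} (F : Hypergraph n) i → 0 < n → 0 < size F → i ≤ n →
  ∣ highDegreeVertices F ∣ ≤ i → size F < 2 * wp F i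
wp-large-if-few-high-degree F i 0<n 0<m i≤n high≤i
  with I , high⊆I , refl ← superset-of-size i (highDegreeVertices F) high≤i i≤n = begin-strict
  size F              <⟨ majority-inside-if-outside-low F I 0<n outside-low 0<m ⟩
  2 * edgesInside F I ≤⟨ *-monoʳ-≤ 2 (edgesInside≤wp F I) ⟩
  2 * wp F ∣ I ∣      ∎
  where
  open ≤-Reasoning
  outside-low : ∀ v → v ∉ I → ¬ HighDegree F v
  outside-low v v∉I high = v∉I (high⊆I (∈-subsetOf⁺ (highDegree? F) high))

lemma2p2 : (n : ℕ) (F : Hypergraph n) (i : ℕ) → 0 < i → i < n →
    2 * wp F i ≤ size F →
    Σ (Subset n) (λ S → (i ≤ ∣ S ∣) × (∀ v → v ∈ S → size F ≤ 2 * n * degree F v))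
lemma2p2 n F i 0<i i<n 2wp≤m with size F ≟ 0 | i ≤? ∣ highDegreeVertices F ∣
... | yes m≡0 | _ =
  ⊤ , subst (i ≤_) (sym (∣⊤∣≡n n)) (<⇒≤ i<n) , λ v _ → subst (_≤ 2 * n * degree F v) (sym m≡0) z≤n
... | no _ | yes i≤∣high∣ = highDegreeVertices F , i≤∣high∣ , λ v → ∈-subsetOf⁻ (highDegree? F)
... | no m≢0 | no i≰∣high∣ = contradiction 2wp≤m (<⇒≱
  (wp-large-if-few-high-degree F i (<-trans 0<i i<n) (n≢0⇒n>0 m≢0) (<⇒≤ i<n) (<⇒≤ (≰⇒> i≰∣high∣))))
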